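{- Let $\mathbf{A}$ be a Heyting algebra with involution. Then there is a one-to-one correspondence between the set of all congruences of $\mathbf{A}$ and the set of all involutive filters of $\mathbf{A}$, given by sending an involutive filter $F$ to the relation $\Theta(F)$ defined by $\Theta(F)(a,b)\iff (a\to b)\land(b\to a)\in F$, and a congruence $\Theta$ to $F(\Theta)=\{a\in A:\Theta(a,1)\}$.
   Context: A Heyting algebra is $\langle A,\lor,\land,\to,\neg,0,1\rangle$ where $\langle A,\lor,\land,0,1\rangle$ is a bounded lattice, $a\to b=\sup\{x: a\land x\le b\}$, and $\neg a=a\to 0$. A Heyting algebra with involution is an algebra $\langle A,\lor,\land,\to,\neg,\sim,0,1\rangle$ which is a Heyting algebra together with a unary operation $\sim$ satisfying $\sim(a\lor b)=\sim a\land\sim b$ and $\sim\sim a=a$. A filter of $\mathbf{A}$ is a lattice filter (nonempty subset closed under $\land$ and upward closed). A filter $F$ is involutive if $a\in F$ implies $\neg\sim a\in F$. Congruences are congruences with respect to all operations $\lor,\land,\to,\neg,\sim$. -}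

module Defs where

open import Level using (Level; _⊔_; suc)
open import Data.Product using (_×_; ∃)
open import Relation.Unary using (Pred; _∈_)
open import Relation.Binary.Core using (Rel)
open import Relation.Binary.Structures using (IsEquivalence)
open import Relation.Binary.Lattice.Bundles using (HeytingAlgebra)
open import Algebra.Core using (Op₁)

record HeytingAlgebraWithInvolution c ℓ₁ ℓ₂ : Set (suc (c ⊔ ℓ₁ ⊔ ℓ₂)) where
  field
    heytingAlgebra : HeytingAlgebra c ℓ₁ ℓ₂
  open HeytingAlgebra heytingAlgebra public
  field
    ∼_     : Op₁ Carrier
    ∼-cong : ∀ {a b} → a ≈ b → (∼ a) ≈ (∼ b)
    ∼-∨    : ∀ a b → (∼ (a ∨ b)) ≈ ((∼ a) ∧ (∼ b))
    ∼-invol : ∀ a → (∼ (∼ a)) ≈ a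

  ¬_ : Op₁ Carrier
  ¬ a = a ⇨ ⊥

module HAIDefs {c ℓ₁ ℓ₂} (A : HeytingAlgebraWithInvolution c ℓ₁ ℓ₂) where
  open HeytingAlgebraWithInvolution A

  record IsFilter {p : Level} (F : Pred Carrier p) : Set (c ⊔ ℓ₂ ⊔ p) where
    field
      nonempty : ∃ λ a → a ∈ F
      ∧-closed : ∀ {a b} → a ∈ F → b ∈ F → (a ∧ b) ∈ F
      up-closed : ∀ {a b} → a ∈ F → a ≤ b → b ∈ F

  record IsInvolutiveFilter {p : Level} (F : Pred Carrier p) : Set (c ⊔ ℓ₂ ⊔ p) where
    field
      isFilter : IsFilter F
      involutive : ∀ {a} → a ∈ F → (¬ (∼ a)) ∈ F

  record IsCongruence {p : Level} (Θ : Rel Carrier p) : Set (c ⊔ ℓ₁ ⊔ p) where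
    field
      isEquivalence : IsEquivalence Θ
      ≈⇒Θ   : ∀ {a b} → a ≈ b → Θ a b
      ∨-compat : ∀ {a b a' b'} → Θ a a' → Θ b b' → Θ (a ∨ b) (a' ∨ b')
      ∧-compat : ∀ {a b a' b'} → Θ a a' → Θ b b' → Θ (a ∧ b) (a' ∧ b')
      ⇨-compat : ∀ {a b a' b'} → Θ a a' → Θ b b' → Θ (a ⇨ b) (a' ⇨ b')
      ¬-compat : ∀ {a a'} → Θ a a' → Θ (¬ a) (¬ a')
      ∼-compat : ∀ {a a'} → Θ a a' → Θ (∼ a) (∼ a')

  Θ[_] : ∀ {p} → Pred Carrier p → Rel Carrier p
  Θ[ F ] a b = ((a ⇨ b) ∧ (b ⇨ a)) ∈ F

  F[_] : ∀ {p} → Rel Carrier p → Pred Carrier p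
  F[ Θ ] a = Θ a ⊤

  _≐ₚ_ : ∀ {p} → Pred Carrier p → Pred Carrier p → Set (c ⊔ p)
  F ≐ₚ G = ∀ a → (F a → G a) × (G a → F a)

  _≐ᵣ_ : ∀ {p} → Rel Carrier p → Rel Carrier p → Set (c ⊔ p)
  R ≐ᵣ S = ∀ a b → (R a b → S a b) × (S a b → R a b)

-- Θ[ F ] relates a and b when a ⇔ b ∈ F. For any filter it is compatible with
-- ∨, ∧ and ⇨, since (a ⇔ a') ∧ (b ⇔ b') ≤ (a ∘ b) ⇔ (a' ∘ b') for each of these
-- operations ∘; compatibility with ∼ needs involutivity, through
-- ¬ ∼ (a ⇨ b) ≤ ∼ b ⇨ ∼ a. The two maps are mutually inverse because a ⇔ ⊤ ≈ a and
-- a ∧ (a ⇔ b) ≈ b ∧ (a ⇔ b), and the class of ⊤ is involutive because ¬ ∼ ⊤ ≈ ⊤.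
module Submission where

open import Defs
open import Level using (Level)
open import Algebra.Core using (Op₂)
open import Data.Product using (_×_; _,_; proj₂)
open import Relation.Unary using (Pred; _∈_)
open import Relation.Binary.Core using (Rel)
open import Relation.Binary.Bundles using (Setoid)
open import Relation.Binary.Structures using (IsEquivalence)
open import Relation.Binary.Lattice.Bundles using (HeytingAlgebra)
import Relation.Binary.Lattice.Properties.HeytingAlgebra as HeytingAlgebraProperties
import Relation.Binary.Lattice.Properties.MeetSemilattice as MeetSemilatticeProperties
import Relation.Binary.Lattice.Properties.JoinSemilattice as JoinSemilatticeProperties
import Relation.Binary.Lattice.Properties.BoundedMeetSemilattice as BoundedMeetSemilatticeProperties
import Relation.Binary.Lattice.Properties.BoundedLattice as BoundedLatticeProperties
import Relation.Binary.Reasoning.PartialOrder as ≤-Reasoning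
import Relation.Binary.Reasoning.Setoid as ≈-Reasoning

module Biimplication {c ℓ₁ ℓ₂} (H : HeytingAlgebra c ℓ₁ ℓ₂) where
  open HeytingAlgebra H
  open HeytingAlgebraProperties H using (⇨-eval; ∧-distribˡ-∨-≤)
  open MeetSemilatticeProperties meetSemilattice using (∧-monotonic)
  open JoinSemilatticeProperties joinSemilattice using (∨-monotonic)

  infix 5 _⇔_
  _⇔_ : Op₂ Carrier
  x ⇔ y = (x ⇨ y) ∧ (y ⇨ x)

  ⇨-mp : ∀ {w x y} → w ≤ x ⇨ y → w ≤ x → w ≤ y
  ⇨-mp w≤x⇨y w≤x = trans (∧-greatest w≤x⇨y w≤x) ⇨-eval

  ⇨-evalˡ : ∀ {x x' v} → ((x ⇨ x') ∧ v) ∧ x ≤ x'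
  ⇨-evalˡ = trans (∧-monotonic (x∧y≤x _ _) refl) ⇨-eval

  ⇨-evalʳ : ∀ {u y y'} → (u ∧ (y ⇨ y')) ∧ y ≤ y'
  ⇨-evalʳ = trans (∧-monotonic (x∧y≤y _ _) refl) ⇨-eval

  ⇨-trans : ∀ {x y z} → (x ⇨ y) ∧ (y ⇨ z) ≤ x ⇨ z
  ⇨-trans = transpose-⇨ (⇨-mp (trans (x∧y≤x _ _) (x∧y≤y _ _)) ⇨-evalˡ)

  ⇨-∨-monotonic : ∀ {x x' y y'} → (x ⇨ x') ∧ (y ⇨ y') ≤ x ∨ y ⇨ x' ∨ y'
  ⇨-∨-monotonic = transpose-⇨
    (trans (∧-distribˡ-∨-≤ _ _ _) (∨-monotonic ⇨-evalˡ ⇨-evalʳ))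

  ⇨-∧-monotonic : ∀ {x x' y y'} → (x ⇨ x') ∧ (y ⇨ y') ≤ x ∧ y ⇨ x' ∧ y'
  ⇨-∧-monotonic = transpose-⇨ (∧-greatest
    (trans (∧-monotonic refl (x∧y≤x _ _)) ⇨-evalˡ)
    (trans (∧-monotonic refl (x∧y≤y _ _)) ⇨-evalʳ))

  ⇨-⇨-monotonic : ∀ {x x' y y'} → (x' ⇨ x) ∧ (y ⇨ y') ≤ (x ⇨ y) ⇨ (x' ⇨ y')
  ⇨-⇨-monotonic = transpose-⇨ (trans
    (∧-greatest (trans (∧-monotonic (x∧y≤x _ _) refl) ⇨-trans)
                (trans (x∧y≤x _ _) (x∧y≤y _ _)))
    ⇨-trans)

  ⇔-reflexive : ∀ {x y} → x ≈ y → ⊤ ≤ x ⇔ y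
  ⇔-reflexive x≈y = ∧-greatest
    (transpose-⇨ (trans (x∧y≤y _ _) (reflexive x≈y)))
    (transpose-⇨ (trans (x∧y≤y _ _) (reflexive (Eq.sym x≈y))))

  ⇔-refl : ∀ {x} → x ⇔ x ≈ ⊤
  ⇔-refl = antisym (maximum _) (⇔-reflexive Eq.refl)

  ⇔-sym : ∀ {x y} → x ⇔ y ≤ y ⇔ x
  ⇔-sym = ∧-greatest (x∧y≤y _ _) (x∧y≤x _ _)

  ⇔-trans : ∀ {x y z} → (x ⇔ y) ∧ (y ⇔ z) ≤ x ⇔ z
  ⇔-trans = ∧-greatest
    (trans (∧-monotonic (x∧y≤x _ _) (x∧y≤x _ _)) ⇨-trans)
    (trans (∧-greatest (trans (x∧y≤y _ _) (x∧y≤y _ _))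
                       (trans (x∧y≤x _ _) (x∧y≤y _ _))) ⇨-trans)

  ⇔-∨ : ∀ {x x' y y'} → (x ⇔ x') ∧ (y ⇔ y') ≤ x ∨ y ⇔ x' ∨ y'
  ⇔-∨ = ∧-greatest
    (trans (∧-monotonic (x∧y≤x _ _) (x∧y≤x _ _)) ⇨-∨-monotonic)
    (trans (∧-monotonic (x∧y≤y _ _) (x∧y≤y _ _)) ⇨-∨-monotonic)

  ⇔-∧ : ∀ {x x' y y'} → (x ⇔ x') ∧ (y ⇔ y') ≤ x ∧ y ⇔ x' ∧ y'
  ⇔-∧ = ∧-greatest
    (trans (∧-monotonic (x∧y≤x _ _) (x∧y≤x _ _)) ⇨-∧-monotonic)
    (trans (∧-monotonic (x∧y≤y _ _) (x∧y≤y _ _)) ⇨-∧-monotonic)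

  ⇔-⇨ : ∀ {x x' y y'} → (x ⇔ x') ∧ (y ⇔ y') ≤ (x ⇨ y) ⇔ (x' ⇨ y')
  ⇔-⇨ = ∧-greatest
    (trans (∧-monotonic (x∧y≤y _ _) (x∧y≤x _ _)) ⇨-⇨-monotonic)
    (trans (∧-monotonic (x∧y≤x _ _) (x∧y≤y _ _)) ⇨-⇨-monotonic)

  ⇔-⊤ : ∀ {x} → x ⇔ ⊤ ≈ x
  ⇔-⊤ = antisym (⇨-mp (x∧y≤y _ _) (maximum _))
                (∧-greatest (transpose-⇨ (maximum _)) (transpose-⇨ (x∧y≤x _ _)))

  x∧[x⇔y]≤y : ∀ {x y} → x ∧ (x ⇔ y) ≤ y
  x∧[x⇔y]≤y = ⇨-mp (trans (x∧y≤y _ _) (x∧y≤x _ _)) (x∧y≤x _ _)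

  x∧[x⇔y]≈y∧[x⇔y] : ∀ {x y} → x ∧ (x ⇔ y) ≈ y ∧ (x ⇔ y)
  x∧[x⇔y]≈y∧[x⇔y] = antisym
    (∧-greatest x∧[x⇔y]≤y (x∧y≤y _ _))
    (∧-greatest (trans (∧-monotonic refl ⇔-sym) x∧[x⇔y]≤y) (x∧y≤y _ _))

module Involution {c ℓ₁ ℓ₂} (A : HeytingAlgebraWithInvolution c ℓ₁ ℓ₂) where
  open HeytingAlgebraWithInvolution A
  open HeytingAlgebraProperties heytingAlgebra using (⇨-eval; ∧-distribˡ-∨-≤)
  open MeetSemilatticeProperties meetSemilattice using (∧-monotonic; ∧-cong)
  open JoinSemilatticeProperties joinSemilattice using (x≤y⇒x∨y≈y)

  ∼-antitone : ∀ {x y} → x ≤ y → ∼ y ≤ ∼ x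
  ∼-antitone {x} {y} x≤y = begin
    ∼ y           ≈⟨ ∼-cong (Eq.sym (x≤y⇒x∨y≈y x≤y)) ⟩
    ∼ (x ∨ y)     ≈⟨ ∼-∨ x y ⟩
    ∼ x ∧ ∼ y     ≤⟨ x∧y≤x _ _ ⟩
    ∼ x           ∎
    where open ≤-Reasoning poset

  ∼-∧ : ∀ x y → ∼ (x ∧ y) ≈ ∼ x ∨ ∼ y
  ∼-∧ x y = begin
    ∼ (x ∧ y)               ≈⟨ ∼-cong (∧-cong (∼-invol x) (∼-invol y)) ⟨
    ∼ (∼ (∼ x) ∧ ∼ (∼ y))   ≈⟨ ∼-cong (∼-∨ (∼ x) (∼ y)) ⟨
    ∼ (∼ (∼ x ∨ ∼ y))       ≈⟨ ∼-invol _ ⟩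
    ∼ x ∨ ∼ y               ∎
    where open ≈-Reasoning setoid

  ¬∼⊤≈⊤ : ¬ (∼ ⊤) ≈ ⊤
  ¬∼⊤≈⊤ = antisym (maximum _) (transpose-⇨ (trans (x∧y≤y _ _) ∼⊤≤⊥))
    where
    ∼⊤≤⊥ : ∼ ⊤ ≤ ⊥
    ∼⊤≤⊥ = trans (∼-antitone (maximum (∼ ⊥))) (reflexive (∼-invol ⊥))

  ¬∼[x⇨y]≤∼y⇨∼x : ∀ x y → ¬ (∼ (x ⇨ y)) ≤ ∼ y ⇨ ∼ x
  ¬∼[x⇨y]≤∼y⇨∼x x y = transpose-⇨ (begin
    ¬ ∼ e ∧ ∼ y                       ≤⟨ ∧-monotonic refl (∼-antitone ⇨-eval) ⟩
    ¬ ∼ e ∧ ∼ (e ∧ x)                 ≈⟨ ∧-cong Eq.refl (∼-∧ e x) ⟩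
    ¬ ∼ e ∧ (∼ e ∨ ∼ x)               ≤⟨ ∧-distribˡ-∨-≤ _ _ _ ⟩
    (¬ ∼ e ∧ ∼ e) ∨ (¬ ∼ e ∧ ∼ x)     ≤⟨ ∨-least (trans ⇨-eval (minimum _)) (x∧y≤y _ _) ⟩
    ∼ x                               ∎)
    where
    e : Carrier
    e = x ⇨ y
    open ≤-Reasoning poset

module FiltersAndCongruences {c ℓ₁ ℓ₂} (A : HeytingAlgebraWithInvolution c ℓ₁ ℓ₂) where
  open HeytingAlgebraWithInvolution A
  open HAIDefs A
  open Biimplication heytingAlgebra
  open Involution A using (¬∼⊤≈⊤; ¬∼[x⇨y]≤∼y⇨∼x)
  open MeetSemilatticeProperties meetSemilattice using (∧-monotonic; ∧-idempotent)
  open JoinSemilatticeProperties joinSemilattice using (x≤y⇒x∨y≈y)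
  open BoundedMeetSemilatticeProperties boundedMeetSemilattice using (identityʳ)
  open BoundedLatticeProperties boundedLattice using (∨-zeroˡ)

  module _ {p} {F : Pred Carrier p} (F-isFilter : IsFilter F) where
    open IsFilter F-isFilter

    ⊤∈F : ⊤ ∈ F
    ⊤∈F = up-closed (proj₂ nonempty) (maximum _)

    ∈-∧-upward : ∀ {x y z} → x ∈ F → y ∈ F → x ∧ y ≤ z → z ∈ F
    ∈-∧-upward x∈F y∈F x∧y≤z = up-closed (∧-closed x∈F y∈F) x∧y≤z

    Θ[F]-compatible : ∀ {f : Op₂ Carrier} →
      (∀ {x x' y y'} → (x ⇔ x') ∧ (y ⇔ y') ≤ f x y ⇔ f x' y') →
      ∀ {x x' y y'} → Θ[ F ] x x' → Θ[ F ] y y' → Θ[ F ] (f x y) (f x' y')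
    Θ[F]-compatible ⇔-f θ₁ θ₂ = ∈-∧-upward θ₁ θ₂ ⇔-f

    Θ[F]-reflexive : ∀ {x y} → x ≈ y → Θ[ F ] x y
    Θ[F]-reflexive x≈y = up-closed ⊤∈F (⇔-reflexive x≈y)

    Θ[F]-isEquivalence : IsEquivalence Θ[ F ]
    Θ[F]-isEquivalence = record
      { refl  = Θ[F]-reflexive Eq.refl
      ; sym   = λ θ → up-closed θ ⇔-sym
      ; trans = λ θ₁ θ₂ → ∈-∧-upward θ₁ θ₂ ⇔-trans
      }

    F[Θ[F]]≐F : F[ Θ[ F ] ] ≐ₚ F
    F[Θ[F]]≐F _ = (λ θ → up-closed θ (reflexive ⇔-⊤))
                , (λ a∈F → up-closed a∈F (reflexive (Eq.sym ⇔-⊤)))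

  Θ[F]-isCongruence : ∀ {p} {F : Pred Carrier p} →
    IsInvolutiveFilter F → IsCongruence Θ[ F ]
  Θ[F]-isCongruence {F = F} F-isInvolutive = record
    { isEquivalence = Θ[F]-isEquivalence isFilter
    ; ≈⇒Θ      = Θ[F]-reflexive isFilter
    ; ∨-compat = Θ[F]-compatible isFilter ⇔-∨
    ; ∧-compat = Θ[F]-compatible isFilter ⇔-∧
    ; ⇨-compat = ⇨-compat
    ; ¬-compat = λ θ → ⇨-compat θ (Θ[F]-reflexive isFilter Eq.refl)
    ; ∼-compat = ∼-compat
    }
    where
    open IsInvolutiveFilter F-isInvolutive
    open IsFilter isFilter using (up-closed)

    ⇨-compat : ∀ {x x' y y'} → Θ[ F ] x x' → Θ[ F ] y y' → Θ[ F ] (x ⇨ y) (x' ⇨ y')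
    ⇨-compat = Θ[F]-compatible isFilter ⇔-⇨

    ∼-compat : ∀ {x x'} → Θ[ F ] x x' → Θ[ F ] (∼ x) (∼ x')
    ∼-compat {x} {x'} θ = ∈-∧-upward isFilter
      (involutive (up-closed θ (x∧y≤y _ _)))
      (involutive (up-closed θ (x∧y≤x _ _)))
      (∧-monotonic (¬∼[x⇨y]≤∼y⇨∼x x' x) (¬∼[x⇨y]≤∼y⇨∼x x x'))

  module _ {p} {Θ : Rel Carrier p} (Θ-isCongruence : IsCongruence Θ) where
    open IsCongruence Θ-isCongruence

    private
      Θ-setoid : Setoid c p
      Θ-setoid = record { isEquivalence = IsCongruence.isEquivalence Θ-isCongruence }
    open Setoid Θ-setoid using () renaming (refl to Θ-refl)
    open ≈-Reasoning Θ-setoid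

    F[Θ]-isInvolutiveFilter : IsInvolutiveFilter F[ Θ ]
    F[Θ]-isInvolutiveFilter = record
      { isFilter = record
        { nonempty  = ⊤ , Θ-refl
        ; ∧-closed  = λ {x} {y} θx θy → begin
            x ∧ y   ≈⟨ ∧-compat θx θy ⟩
            ⊤ ∧ ⊤   ≈⟨ ≈⇒Θ (∧-idempotent ⊤) ⟩
            ⊤       ∎
        ; up-closed = λ {x} {y} θx x≤y → begin
            y       ≈⟨ ≈⇒Θ (Eq.sym (x≤y⇒x∨y≈y x≤y)) ⟩
            x ∨ y   ≈⟨ ∨-compat θx Θ-refl ⟩
            ⊤ ∨ y   ≈⟨ ≈⇒Θ (∨-zeroˡ y) ⟩
            ⊤       ∎
        }
      ; involutive = λ {x} θx → begin
          ¬ ∼ x   ≈⟨ ¬-compat (∼-compat θx) ⟩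
          ¬ ∼ ⊤   ≈⟨ ≈⇒Θ ¬∼⊤≈⊤ ⟩
          ⊤       ∎
      }

    Θ[F[Θ]]≐Θ : Θ[ F[ Θ ] ] ≐ᵣ Θ
    Θ[F[Θ]]≐Θ a b = to , from
      where
      to : Θ (a ⇔ b) ⊤ → Θ a b
      to θ = begin
        a               ≈⟨ ≈⇒Θ (Eq.sym (identityʳ a)) ⟩
        a ∧ ⊤           ≈⟨ ∧-compat Θ-refl θ ⟨
        a ∧ (a ⇔ b)     ≈⟨ ≈⇒Θ x∧[x⇔y]≈y∧[x⇔y] ⟩
        b ∧ (a ⇔ b)     ≈⟨ ∧-compat Θ-refl θ ⟩
        b ∧ ⊤           ≈⟨ ≈⇒Θ (identityʳ b) ⟩
        b               ∎

      from : Θ a b → Θ (a ⇔ b) ⊤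
      from θ = begin
        a ⇔ b               ≈⟨ ∧-compat (⇨-compat θ Θ-refl) (⇨-compat Θ-refl θ) ⟩
        b ⇔ b               ≈⟨ ≈⇒Θ ⇔-refl ⟩
        ⊤                   ∎

lemma3p1 : ∀ {c ℓ₁ ℓ₂ p : Level} (A : HeytingAlgebraWithInvolution c ℓ₁ ℓ₂) →
  let open HeytingAlgebraWithInvolution A using (Carrier)
      open HAIDefs A
  in ((F : Pred Carrier p) → IsInvolutiveFilter F →
        IsCongruence Θ[ F ] × (F[ Θ[ F ] ] ≐ₚ F))
     × ((Θ : Rel Carrier p) → IsCongruence Θ →
        IsInvolutiveFilter F[ Θ ] × (Θ[ F[ Θ ] ] ≐ᵣ Θ))
lemma3p1 A =
  (λ F F-isInvolutive →
     Θ[F]-isCongruence F-isInvolutive , F[Θ[F]]≐F (isFilter F-isInvolutive)) ,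
  (λ Θ Θ-isCongruence →
     F[Θ]-isInvolutiveFilter Θ-isCongruence , Θ[F[Θ]]≐Θ Θ-isCongruence)
  where
  open FiltersAndCongruences A
  open HAIDefs.IsInvolutiveFilter using (isFilter)
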